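{- Let $k\langle X\rangle$ be the vector space over a field $k$ with basis $X^*$, equipped with the shifted concatenation $*$ extended bilinearly (and unit the empty word $1_{X^*}$), and let $\mathcal H\subseteq k\langle X\rangle$ be the span of the packed words with the same product. Then the linear extension of $pack$, $pack:k\langle X\rangle\to\mathcal H$, is a morphism of associative algebras with unit; i.e. $pack(u*v)=pack(u)*pack(v)$ for all $u,v\in X^*$ and $pack(1_{X^*})=1_{X^*}$.
   Context: $X=\{x_i\}_{i\ge 0}$ is an alphabet totally ordered by index, $X^*$ the free monoid of words over $X$ with empty word $1_{X^*}$. For a word $w$, $IAlph(w)=\{i\in\mathbb N: x_i\text{ occurs in }w\}$ and $sup(w)$ is the supremum of $IAlph(w)$ in $\mathbb N$ ($sup(1_{X^*})=0$). For $\phi$ on $IAlph(w)$ with values in $\mathbb N$ and $\phi(0)=0$, $S_\phi(x_{i_1}\cdots x_{i_m})=x_{\phi(i_1)}\cdots x_{\phi(i_m)}$. If $IAlph(w)\setminus\{0\}=\{j_1<\dots<j_k\}$, let $\phi_w(j_m)=m$, $\phi_w(0)=0$ and $pack(w)=S_{\phi_w}(w)$; $w$ is packed if $pack(w)=w$. For $t\in\mathbb N$, $T_t(w)=S_\phi(w)$ with $\phi(n)=n+t$ for $n>0$, $\phi(0)=0$. The shifted concatenation is $u*v=u\,T_{sup(u)}(v)$. -}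

module Defs where

open import Data.Nat using (ℕ; zero; suc; _+_; _⊔_; _≤?_; _<?_; _≟_)
open import Data.List using (List; []; map; foldr; filter; length; deduplicate; _++_)
open import Relation.Nullary.Decidable using (_×-dec_)

-- A word over X = {x_i}_{i ≥ 0} is a list of indices: the letter x_i is i.
Word : Set
Word = List ℕ

1X : Word
1X = []

S : (ℕ → ℕ) → Word → Word
S φ w = map φ w

IAlph : Word → List ℕ
IAlph w = deduplicate _≟_ w

sup : Word → ℕ
sup w = foldr _⊔_ 0 w

-- φ_w : 0 ↦ 0, and the m-th smallest nonzero element j_m of IAlph(w) ↦ m,
-- i.e. j ↦ #{ i ∈ IAlph(w) ∖ {0} : i ≤ j }
φ : Word → ℕ → ℕ
φ w zero = zero
φ w (suc j) = length (filter (λ i → (0 <? i) ×-dec (i ≤? suc j)) (IAlph w))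

pack : Word → Word
pack w = S (φ w) w

shift : ℕ → ℕ → ℕ
shift t zero = zero
shift t (suc n) = suc n + t

T : ℕ → Word → Word
T t w = S (shift t) w

_⋆_ : Word → Word → Word
u ⋆ v = u ++ T (sup u) v

module Submission where

-- We first replace the list-and-filter definition of
-- φ by the recursive "rank"
--     rank w 0 = 0 ,   rank w (1+j) = rank w j + [1+j occurs in w] ,
-- using elementary counting lemmas for filters and for deduplicate.  For the
-- shifted concatenation u ⋆ v = u ++ T_s v with s = sup u, the rank of u ⋆ v
-- agrees with that of u up to s (T_s v has no letter in 1..s), and above s it is
-- rank u s plus the rank of v (letters > s only come from T_s v, shifted by s).
-- Since φ u is monotone with φ u 0 = 0, sup (pack u) = rank u s, so on the letters
-- of u the packing of u ⋆ v is φ u, and on the letters of T_s v it is T_{sup (pack u)}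
-- applied after φ v — which is exactly pack u ⋆ pack v.

open import Defs
open import Data.Empty using (⊥-elim)
open import Data.Nat
open import Data.Nat.Properties
open import Data.List using (List; []; _∷_; map; filter; length; deduplicate; _++_)
open import Data.List.Properties
  using (map-++; map-∘; map-cong-local; length-++; filter-++; filter-accept; filter-reject; filter-none)
open import Data.List.Membership.Propositional using (_∈_; _∉_)
open import Data.List.Membership.Propositional.Properties using (∈-map⁻)
open import Data.List.Relation.Unary.All using (All; tabulate)
open import Data.List.Relation.Unary.All.Properties using (¬Any⇒All¬; all-filter)
open import Data.List.Relation.Unary.Any using (here; there)
open import Data.Product using (_×_; _,_)
open import Data.Sum using (_⊎_; inj₁; inj₂; [_,_]′)
open import Function using (_∘_)
open import Function.Definitions using (Injective)
open import Level using (0ℓ)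
open import Relation.Binary.Core using (_Preserves_⟶_)
open import Relation.Binary.PropositionalEquality
open import Relation.Nullary using (Dec; yes; no; ¬_)
open import Relation.Nullary.Decidable using (_×-dec_; ¬?)
open import Relation.Unary using (Pred; Decidable)

count : {P : Pred ℕ 0ℓ} → Decidable P → List ℕ → ℕ
count P? xs = length (filter P? xs)

occ : ℕ → Word → ℕ
occ k = count (k ≟_)

count-accept : {P : Pred ℕ 0ℓ} (P? : Decidable P) {x : ℕ} {xs : List ℕ} →
               P x → count P? (x ∷ xs) ≡ suc (count P? xs)
count-accept P? p = cong length (filter-accept P? p)

count-reject : {P : Pred ℕ 0ℓ} (P? : Decidable P) {x : ℕ} {xs : List ℕ} →
               ¬ P x → count P? (x ∷ xs) ≡ count P? xs
count-reject P? ¬p = cong length (filter-reject P? ¬p)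

count-none : {P : Pred ℕ 0ℓ} (P? : Decidable P) {xs : List ℕ} →
             All (¬_ ∘ P) xs → count P? xs ≡ 0
count-none P? none = cong length (filter-none P? none)

count-⊎ : {P Q R : Pred ℕ 0ℓ} (P? : Decidable P) (Q? : Decidable Q) (R? : Decidable R) →
          (∀ {x} → P x → Q x ⊎ R x) → (∀ {x} → Q x → P x) → (∀ {x} → R x → P x) →
          (∀ {x} → Q x → ¬ R x) →
          ∀ xs → count P? xs ≡ count Q? xs + count R? xs
count-⊎ P? Q? R? split Q⇒P R⇒P disjoint [] = refl
count-⊎ {P} {Q} {R} P? Q? R? split Q⇒P R⇒P disjoint (x ∷ xs) = step (Q? x) (R? x)
  where
  open ≡-Reasoning
  ih : count P? xs ≡ count Q? xs + count R? xs
  ih = count-⊎ P? Q? R? split Q⇒P R⇒P disjoint xs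

  step : Dec (Q x) → Dec (R x) → count P? (x ∷ xs) ≡ count Q? (x ∷ xs) + count R? (x ∷ xs)
  step (yes q) (yes r) = ⊥-elim (disjoint q r)
  step (yes q) (no ¬r) = begin
    count P? (x ∷ xs)                     ≡⟨ count-accept P? (Q⇒P q) ⟩
    suc (count P? xs)                     ≡⟨ cong suc ih ⟩
    suc (count Q? xs + count R? xs)       ≡⟨ cong₂ _+_ (sym (count-accept Q? q)) (sym (count-reject R? ¬r)) ⟩
    count Q? (x ∷ xs) + count R? (x ∷ xs) ∎
  step (no ¬q) (yes r) = begin
    count P? (x ∷ xs)                     ≡⟨ count-accept P? (R⇒P r) ⟩
    suc (count P? xs)                     ≡⟨ cong suc ih ⟩
    suc (count Q? xs + count R? xs)       ≡⟨ sym (+-suc _ _) ⟩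
    count Q? xs + suc (count R? xs)       ≡⟨ cong₂ _+_ (sym (count-reject Q? ¬q)) (sym (count-accept R? r)) ⟩
    count Q? (x ∷ xs) + count R? (x ∷ xs) ∎
  step (no ¬q) (no ¬r) = begin
    count P? (x ∷ xs)                     ≡⟨ count-reject P? (λ p → [ ¬q , ¬r ]′ (split p)) ⟩
    count P? xs                           ≡⟨ ih ⟩
    count Q? xs + count R? xs             ≡⟨ cong₂ _+_ (sym (count-reject Q? ¬q)) (sym (count-reject R? ¬r)) ⟩
    count Q? (x ∷ xs) + count R? (x ∷ xs) ∎

count-∷ : {P : Pred ℕ 0ℓ} (P? : Decidable P) (x : ℕ) (xs : List ℕ) → count P? xs ≤ count P? (x ∷ xs)
count-∷ P? x xs with P? x
... | yes _ = n≤1+n _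
... | no _ = ≤-refl

count-filter : {P Q : Pred ℕ 0ℓ} (P? : Decidable P) (Q? : Decidable Q) →
               (∀ {x} → P x → Q x) → ∀ xs → count P? (filter Q? xs) ≡ count P? xs
count-filter P? Q? P⇒Q [] = refl
count-filter {P} {Q} P? Q? P⇒Q (x ∷ xs) = step (Q? x) (P? x)
  where
  open ≡-Reasoning
  ih : count P? (filter Q? xs) ≡ count P? xs
  ih = count-filter P? Q? P⇒Q xs

  step : Dec (Q x) → Dec (P x) → count P? (filter Q? (x ∷ xs)) ≡ count P? (x ∷ xs)
  step (yes q) (yes p) = begin
    count P? (filter Q? (x ∷ xs)) ≡⟨ cong (count P?) (filter-accept Q? q) ⟩
    count P? (x ∷ filter Q? xs)   ≡⟨ count-accept P? p ⟩
    suc (count P? (filter Q? xs)) ≡⟨ cong suc ih ⟩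
    suc (count P? xs)             ≡⟨ sym (count-accept P? p) ⟩
    count P? (x ∷ xs)             ∎
  step (yes q) (no ¬p) = begin
    count P? (filter Q? (x ∷ xs)) ≡⟨ cong (count P?) (filter-accept Q? q) ⟩
    count P? (x ∷ filter Q? xs)   ≡⟨ count-reject P? ¬p ⟩
    count P? (filter Q? xs)       ≡⟨ ih ⟩
    count P? xs                   ≡⟨ sym (count-reject P? ¬p) ⟩
    count P? (x ∷ xs)             ∎
  step (no ¬q) _ = begin
    count P? (filter Q? (x ∷ xs)) ≡⟨ cong (count P?) (filter-reject Q? ¬q) ⟩
    count P? (filter Q? xs)       ≡⟨ ih ⟩
    count P? xs                   ≡⟨ sym (count-reject P? (¬q ∘ P⇒Q)) ⟩
    count P? (x ∷ xs)             ∎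

occ-deduplicate : ∀ k w → occ k (deduplicate _≟_ w) ≡ 1 ⊓ occ k w
occ-deduplicate k [] = refl
occ-deduplicate k (x ∷ w) = step (k ≟ x)
  where
  open ≡-Reasoning
  rest : Word
  rest = filter (¬? ∘ (x ≟_)) (deduplicate _≟_ w)

  step : Dec (k ≡ x) → occ k (x ∷ rest) ≡ 1 ⊓ occ k (x ∷ w)
  step (yes refl) = begin
    occ k (k ∷ rest)       ≡⟨ count-accept (k ≟_) refl ⟩
    suc (occ k rest)       ≡⟨ cong suc (count-none (k ≟_) (all-filter (¬? ∘ (k ≟_)) (deduplicate _≟_ w))) ⟩
    1 ⊓ suc (occ k w)      ≡⟨ cong (1 ⊓_) (sym (count-accept (k ≟_) refl)) ⟩
    1 ⊓ occ k (k ∷ w)      ∎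
  step (no k≢x) = begin
    occ k (x ∷ rest)          ≡⟨ count-reject (k ≟_) k≢x ⟩
    occ k rest                ≡⟨ count-filter (k ≟_) (¬? ∘ (x ≟_)) (λ { refl x≡k → k≢x (sym x≡k) }) (deduplicate _≟_ w) ⟩
    occ k (deduplicate _≟_ w) ≡⟨ occ-deduplicate k w ⟩
    1 ⊓ occ k w               ≡⟨ cong (1 ⊓_) (sym (count-reject (k ≟_) k≢x)) ⟩
    1 ⊓ occ k (x ∷ w)         ∎

occ-∉ : ∀ {k w} → k ∉ w → occ k w ≡ 0
occ-∉ {k} {w} k∉w = count-none (k ≟_) (¬Any⇒All¬ w k∉w)

occ-∈ : ∀ {k w} → k ∈ w → 1 ≤ occ k w
occ-∈ {k} {_ ∷ w} (here refl) = subst (1 ≤_) (sym (count-accept (k ≟_) refl)) (s≤s z≤n)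
occ-∈ {k} {y ∷ w} (there k∈w) = ≤-trans (occ-∈ k∈w) (count-∷ (k ≟_) y w)

occ-++ : ∀ k u v → occ k (u ++ v) ≡ occ k u + occ k v
occ-++ k u v = trans (cong length (filter-++ (k ≟_) u v)) (length-++ (filter (k ≟_) u))

occ-map : ∀ {f : ℕ → ℕ} → Injective _≡_ _≡_ f → ∀ k v → occ (f k) (map f v) ≡ occ k v
occ-map inj k [] = refl
occ-map {f} inj k (y ∷ v) = step (k ≟ y)
  where
  step : Dec (k ≡ y) → occ (f k) (map f (y ∷ v)) ≡ occ k (y ∷ v)
  step (yes refl) = begin
    occ (f k) (f k ∷ map f v) ≡⟨ count-accept (f k ≟_) refl ⟩
    suc (occ (f k) (map f v)) ≡⟨ cong suc (occ-map inj k v) ⟩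
    suc (occ k v)             ≡⟨ sym (count-accept (k ≟_) refl) ⟩
    occ k (k ∷ v)             ∎
    where open ≡-Reasoning
  step (no k≢y) = begin
    occ (f k) (f y ∷ map f v) ≡⟨ count-reject (f k ≟_) (k≢y ∘ inj) ⟩
    occ (f k) (map f v)       ≡⟨ occ-map inj k v ⟩
    occ k v                   ≡⟨ sym (count-reject (k ≟_) k≢y) ⟩
    occ k (y ∷ v)             ∎
    where open ≡-Reasoning

InRange : ℕ → Pred ℕ 0ℓ
InRange j i = 0 < i × i ≤ j

inRange? : ∀ j → Decidable (InRange j)
inRange? j i = (0 <? i) ×-dec (i ≤? j)

rank : Word → ℕ → ℕ
rank w zero = zero
rank w (suc j) = rank w j + 1 ⊓ occ (suc j) w

-- The range 1..(1+j) is the disjoint union of 1..j and {1+j}.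
count-inRange-suc : ∀ j xs → count (inRange? (suc j)) xs ≡ count (inRange? j) xs + occ (suc j) xs
count-inRange-suc j = count-⊎ (inRange? (suc j)) (inRange? j) (suc j ≟_) split
  (λ (0<i , i≤j) → 0<i , m≤n⇒m≤1+n i≤j) (λ { refl → z<s , ≤-refl }) (λ { (_ , i≤j) refl → 1+n≰n i≤j })
  where
  split : ∀ {i} → InRange (suc j) i → InRange j i ⊎ suc j ≡ i
  split (0<i , i≤1+j) with m≤n⇒m<n∨m≡n i≤1+j
  ... | inj₁ i<1+j = inj₁ (0<i , s≤s⁻¹ i<1+j)
  ... | inj₂ i≡1+j = inj₂ (sym i≡1+j)

count-inRange-zero : ∀ xs → count (inRange? 0) xs ≡ 0
count-inRange-zero xs = count-none (inRange? 0) {xs} (tabulate λ _ (0<i , i≤0) → <⇒≱ 0<i i≤0)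

count-inRange-IAlph : ∀ w j → count (inRange? j) (IAlph w) ≡ rank w j
count-inRange-IAlph w zero = count-inRange-zero (IAlph w)
count-inRange-IAlph w (suc j) = begin
  count (inRange? (suc j)) (IAlph w)                ≡⟨ count-inRange-suc j (IAlph w) ⟩
  count (inRange? j) (IAlph w) + occ (suc j) (IAlph w) ≡⟨ cong₂ _+_ (count-inRange-IAlph w j) (occ-deduplicate (suc j) w) ⟩
  rank w j + 1 ⊓ occ (suc j) w                      ∎
  where open ≡-Reasoning

φ≡rank : ∀ w j → φ w j ≡ rank w j
φ≡rank w zero = refl
φ≡rank w (suc j) = count-inRange-IAlph w (suc j)

rank-mono : ∀ w {j k} → j ≤ k → rank w j ≤ rank w k
rank-mono w j≤k = go (≤⇒≤′ j≤k)
  where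
  go : ∀ {j k} → j ≤′ k → rank w j ≤ rank w k
  go ≤′-refl = ≤-refl
  go (≤′-step j≤′k) = ≤-trans (go j≤′k) (m≤m+n _ _)

rank-∈ : ∀ {w n} → suc n ∈ w → rank w (suc n) ≡ suc (rank w n)
rank-∈ {w} {n} 1+n∈w = begin
  rank w n + 1 ⊓ occ (suc n) w ≡⟨ cong (rank w n +_) (m≤n⇒m⊓n≡m (occ-∈ 1+n∈w)) ⟩
  rank w n + 1                 ≡⟨ +-comm (rank w n) 1 ⟩
  suc (rank w n)               ∎
  where open ≡-Reasoning

φ-mono : ∀ w → φ w Preserves _≤_ ⟶ _≤_
φ-mono w {a} {b} a≤b = subst₂ _≤_ (sym (φ≡rank w a)) (sym (φ≡rank w b)) (rank-mono w a≤b)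

∈⇒≤sup : ∀ {x} w → x ∈ w → x ≤ sup w
∈⇒≤sup (y ∷ w) (here refl) = m≤m⊔n y (sup w)
∈⇒≤sup (y ∷ w) (there x∈w) = ≤-trans (∈⇒≤sup w x∈w) (m≤n⊔m y (sup w))

sup-map : ∀ {f : ℕ → ℕ} → f Preserves _≤_ ⟶ _≤_ → f 0 ≡ 0 → ∀ w → sup (map f w) ≡ f (sup w)
sup-map mono f0≡0 [] = sym f0≡0
sup-map {f} mono f0≡0 (x ∷ w) =
  trans (cong (f x ⊔_) (sup-map mono f0≡0 w)) (sym (mono-≤-distrib-⊔ mono x (sup w)))

sup-pack : ∀ u → sup (pack u) ≡ rank u (sup u)
sup-pack u = trans (sup-map (φ-mono u) refl u) (φ≡rank u (sup u))

shift-injective : ∀ t → Injective _≡_ _≡_ (shift t)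
shift-injective t {zero} {zero} _ = refl
shift-injective t {zero} {suc _} ()
shift-injective t {suc _} {zero} ()
shift-injective t {suc m} {suc n} eq = +-cancelʳ-≡ t (suc m) (suc n) eq

shift-positive : ∀ t {a} → 0 < a → shift t a ≡ a + t
shift-positive t {suc a} _ = refl

occ-T-low : ∀ t j v → suc j ≤ t → occ (suc j) (T t v) ≡ 0
occ-T-low t j v 1+j≤t = occ-∉ {w = T t v} λ 1+j∈Tv → let (y , _ , eq) = ∈-map⁻ (shift t) 1+j∈Tv in absurd y eq
  where
  absurd : ∀ y → suc j ≢ shift t y
  absurd (suc n) eq = <⇒≱ (s≤s (≤-trans 1+j≤t (m≤n+m t n))) (≤-reflexive (sym eq))

rank-⋆-low : ∀ u v {j} → j ≤ sup u → rank (u ⋆ v) j ≡ rank u j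
rank-⋆-low u v {zero} _ = refl
rank-⋆-low u v {suc j} 1+j≤s = cong₂ _+_ (rank-⋆-low u v (≤-trans (n≤1+n j) 1+j≤s)) (cong (1 ⊓_) (begin
  occ (suc j) (u ⋆ v)                       ≡⟨ occ-++ (suc j) u (T (sup u) v) ⟩
  occ (suc j) u + occ (suc j) (T (sup u) v) ≡⟨ cong (occ (suc j) u +_) (occ-T-low (sup u) j v 1+j≤s) ⟩
  occ (suc j) u + 0                         ≡⟨ +-identityʳ _ ⟩
  occ (suc j) u                             ∎))
  where open ≡-Reasoning

rank-⋆-high : ∀ u v m → rank (u ⋆ v) (m + sup u) ≡ rank u (sup u) + rank v m
rank-⋆-high u v zero = trans (rank-⋆-low u v ≤-refl) (sym (+-identityʳ _))
rank-⋆-high u v (suc m) = begin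
  rank (u ⋆ v) (m + s) + 1 ⊓ occ (suc m + s) (u ⋆ v) ≡⟨ cong₂ _+_ (rank-⋆-high u v m) (cong (1 ⊓_) occ-high) ⟩
  rank u s + rank v m + 1 ⊓ occ (suc m) v           ≡⟨ +-assoc (rank u s) (rank v m) _ ⟩
  rank u s + rank v (suc m)                         ∎
  where
  open ≡-Reasoning
  s : ℕ
  s = sup u
  occ-high : occ (suc m + s) (u ⋆ v) ≡ occ (suc m) v
  occ-high = begin
    occ (suc m + s) (u ⋆ v)                       ≡⟨ occ-++ (suc m + s) u (T s v) ⟩
    occ (suc m + s) u + occ (suc m + s) (T s v)   ≡⟨ cong₂ _+_ (occ-∉ λ p → <⇒≱ (s≤s (m≤n+m s m)) (∈⇒≤sup u p))
                                                                (occ-map (shift-injective s) (suc m) v) ⟩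
    occ (suc m) v                                 ∎

φ-⋆-left : ∀ u v {x} → x ∈ u → φ (u ⋆ v) x ≡ φ u x
φ-⋆-left u v {x} x∈u = begin
  φ (u ⋆ v) x    ≡⟨ φ≡rank (u ⋆ v) x ⟩
  rank (u ⋆ v) x ≡⟨ rank-⋆-low u v (∈⇒≤sup u x∈u) ⟩
  rank u x       ≡⟨ sym (φ≡rank u x) ⟩
  φ u x          ∎
  where open ≡-Reasoning

φ-⋆-right : ∀ u v {y} → y ∈ v → φ (u ⋆ v) (shift (sup u) y) ≡ shift (sup (pack u)) (φ v y)
φ-⋆-right u v {zero} _ = refl
φ-⋆-right u v {suc n} 1+n∈v = begin
  φ (u ⋆ v) (suc n + s)            ≡⟨ φ≡rank (u ⋆ v) (suc n + s) ⟩
  rank (u ⋆ v) (suc n + s)         ≡⟨ rank-⋆-high u v (suc n) ⟩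
  rank u s + rank v (suc n)        ≡⟨ +-comm (rank u s) _ ⟩
  rank v (suc n) + rank u s        ≡⟨ cong₂ _+_ (sym (φ≡rank v (suc n))) (sym (sup-pack u)) ⟩
  φ v (suc n) + sup (pack u)       ≡⟨ sym (shift-positive (sup (pack u)) φv-positive) ⟩
  shift (sup (pack u)) (φ v (suc n)) ∎
  where
  open ≡-Reasoning
  s : ℕ
  s = sup u
  φv-positive : 0 < φ v (suc n)
  φv-positive = subst (0 <_) (sym (trans (φ≡rank v (suc n)) (rank-∈ 1+n∈v))) z<s

pack-⋆ : ∀ u v → pack (u ⋆ v) ≡ pack u ⋆ pack v
pack-⋆ u v = begin
  map (φ (u ⋆ v)) (u ++ T (sup u) v)                              ≡⟨ map-++ (φ (u ⋆ v)) u (T (sup u) v) ⟩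
  map (φ (u ⋆ v)) u ++ map (φ (u ⋆ v)) (map (shift (sup u)) v)    ≡⟨ cong₂ _++_ left right ⟩
  pack u ++ T (sup (pack u)) (pack v)                             ∎
  where
  open ≡-Reasoning
  left : map (φ (u ⋆ v)) u ≡ pack u
  left = map-cong-local (tabulate (φ-⋆-left u v))
  right : map (φ (u ⋆ v)) (map (shift (sup u)) v) ≡ T (sup (pack u)) (pack v)
  right = begin
    map (φ (u ⋆ v)) (map (shift (sup u)) v)       ≡⟨ sym (map-∘ v) ⟩
    map (φ (u ⋆ v) ∘ shift (sup u)) v             ≡⟨ map-cong-local (tabulate (φ-⋆-right u v)) ⟩
    map (shift (sup (pack u)) ∘ φ v) v            ≡⟨ map-∘ v ⟩
    map (shift (sup (pack u))) (map (φ v) v)      ∎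

mainTheorem7 : ((u v : Word) → pack (u ⋆ v) ≡ pack u ⋆ pack v) × (pack 1X ≡ 1X)
mainTheorem7 = pack-⋆ , refl
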